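{- Let $A$ be an LM$_\theta$-algebra, $X=X(A)$, $f_i=f_i^A$. For $j=1,2$ let $R_j$ be a closed, open and convex subset of $X$, let $G_j=R_j\cup\bigcup_{i\in I}f_i^{ -1}(R_j)$ and $\varphi_j=\Theta_{OS}(G_j)$. Put $S=R_1\setminus\big(R_2\cup\bigcup_{i\in I}f_i^{ -1}(R_1)\big)$. If $S\cap\bigcup_{i\in I}f_i^{ -1}(R_2)$ is a proper and dense subset of $S$ (in the subspace topology), then $\varphi_1\cap\varphi_2$ is not a principal congruence of $A$.
   Context: Let $\theta\ge 2$ be the order type of a totally ordered set $J$ with least element $0$, $J=\{0\}+I$ (ordinal sum). An LM$_\theta$-algebra is an algebra $\langle A,\vee,\wedge,0,1,\{\phi_i\}_{i\in I},\{\overline{\phi}_i\}_{i\in I}\rangle$ with $\langle A,\vee,\wedge,0,1\rangle$ a bounded distributive lattice such that for all $i,j\in I$, $x,y\in A$: $\phi_i$ is a bounded lattice endomorphism; $\phi_i x\vee\overline{\phi}_i x=1$, $\phi_i x\wedge\overline{\phi}_i x=0$; $\phi_i\phi_j x=\phi_j x$; $i\le j$ implies $\phi_i x\le\phi_j x$; $\phi_i x=\phi_i y$ for all $i$ implies $x=y$. A principal congruence is the least congruence of $A$ containing some pair $(a,b)$. $X(A)$ is the set of prime filters of $A$ ordered by inclusion, with subbasis $\sigma_A(a)=\{P:a\in P\}$, $X(A)\setminus\sigma_A(a)$; $f_i^A(P)=\phi_i^{ -1}(P)$. $\Theta_{OS}(G)=\{(x,y)\in A\times A:\sigma_A(y)\triangle\sigma_A(x)\subseteq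 G\}$ (for $G$ as given this is a congruence of $A$). $R$ is convex if $x\le z\le y$, $x,y\in R$ imply $z\in R$. -}

module Defs where

open import Level using (Level; _⊔_) renaming (suc to lsuc; zero to 0ℓ)
open import Data.Product using (Σ; Σ-syntax; _×_; _,_; proj₁; proj₂)
open import Data.Sum using (_⊎_; inj₁; inj₂)
open import Data.Empty using (⊥)
open import Data.List using (List)
open import Data.List.Relation.Unary.All using (All)
open import Relation.Nullary using (¬_)
open import Relation.Binary.PropositionalEquality using (_≡_; refl; sym; trans; cong; subst)
open import Relation.Binary.Structures using (IsTotalOrder)
import Algebra.Lattice.Structures as LS

-- The index chain I, where J = {0} + I has order type θ ≥ 2,
-- i.e. I is a nonempty totally ordered set.

record Chain : Set₁ where
  field
    I            : Set
    _≼_          : I → I → Set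
    isTotalOrder : IsTotalOrder _≡_ _≼_
    inhabitant   : I

record LMAlgebra (C : Chain) : Set₁ where
  open Chain C
  infixr 6 _∨_
  infixr 7 _∧_
  field
    Carrier  : Set
    _∨_ _∧_  : Carrier → Carrier → Carrier
    𝟘 𝟙      : Carrier
    φ φ̄      : I → Carrier → Carrier
    isDistributiveLattice : LS.IsDistributiveLattice (_≡_ {A = Carrier}) _∨_ _∧_
    ∨-𝟘      : ∀ x → x ∨ 𝟘 ≡ x
    ∧-𝟙      : ∀ x → x ∧ 𝟙 ≡ x
    φ-∨      : ∀ i x y → φ i (x ∨ y) ≡ φ i x ∨ φ i y
    φ-∧      : ∀ i x y → φ i (x ∧ y) ≡ φ i x ∧ φ i y
    φ-𝟘      : ∀ i → φ i 𝟘 ≡ 𝟘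
    φ-𝟙      : ∀ i → φ i 𝟙 ≡ 𝟙
    φ-φ̄-∨    : ∀ i x → φ i x ∨ φ̄ i x ≡ 𝟙
    φ-φ̄-∧    : ∀ i x → φ i x ∧ φ̄ i x ≡ 𝟘
    φφ       : ∀ i j x → φ i (φ j x) ≡ φ j x
    φ-mono   : ∀ i j x → i ≼ j → φ i x ∧ φ j x ≡ φ i x
    determ   : ∀ x y → (∀ i → φ i x ≡ φ i y) → x ≡ y

  _≤_ : Carrier → Carrier → Set
  x ≤ y = x ∧ y ≡ x

module _ {C : Chain} (A : LMAlgebra C) where
  open Chain C
  open LMAlgebra A

  record IsPrimeFilter (P : Carrier → Set) : Set where
    field
      𝟙∈      : P 𝟙
      𝟘∉      : ¬ P 𝟘
      up      : ∀ {x y} → P x → x ≤ y → P y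
      ∧-closed : ∀ {x y} → P x → P y → P (x ∧ y)
      prime   : ∀ {x y} → P (x ∨ y) → P x ⊎ P y

  X : Set₁
  X = Σ (Carrier → Set) IsPrimeFilter

  _∈_ : Carrier → X → Set
  a ∈ P = proj₁ P a

  _⊆X_ : X → X → Set
  P ⊆X Q = ∀ a → a ∈ P → a ∈ Q

  σ : Carrier → X → Set
  σ a P = a ∈ P

  f : I → X → X
  f i (P , pf) = (λ x → P (φ i x)) , record
    { 𝟙∈ = subst P (sym (φ-𝟙 i)) 𝟙∈
    ; 𝟘∉ = λ p → 𝟘∉ (subst P (φ-𝟘 i) p)
    ; up = λ {x} {y} px x≤y →
        up px (trans (sym (φ-∧ i x y)) (cong (φ i) x≤y))
    ; ∧-closed = λ {x} {y} px py → subst P (sym (φ-∧ i x y)) (∧-closed px py)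
    ; prime = λ {x} {y} p → prime (subst P (φ-∨ i x y) p)
    }
    where open IsPrimeFilter pf

  Subset : Set₂
  Subset = X → Set₁

  -- basic open sets of the Priestley topology: finite intersections of
  -- subbasic sets σ(a) and X ∖ σ(b)
  Basic : List Carrier → List Carrier → X → Set
  Basic as bs P = All (λ a → a ∈ P) as × All (λ b → ¬ (b ∈ P)) bs

  IsOpen : Subset → Set₁
  IsOpen U = ∀ P → U P →
    Σ[ as ∈ List Carrier ] Σ[ bs ∈ List Carrier ]
      (Basic as bs P × (∀ Q → Basic as bs Q → U Q))

  IsClosed : Subset → Set₁
  IsClosed R = IsOpen (λ P → ¬ R P)

  IsConvex : Subset → Set₁
  IsConvex R = ∀ P Q Z → R P → R Q → P ⊆X Z → Z ⊆X Q → R Z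

  _⁻¹[_] : I → Subset → Subset
  (i ⁻¹[ R ]) P = R (f i P)

  G : Subset → Subset
  G R P = R P ⊎ Σ[ i ∈ I ] (i ⁻¹[ R ]) P

  Θ-OS : Subset → Carrier → Carrier → Set₁
  Θ-OS H x y = ∀ P → ((σ y P × ¬ σ x P) ⊎ (σ x P × ¬ σ y P)) → H P

  record IsCongruence {ℓ : Level} (ψ : Carrier → Carrier → Set ℓ) : Set ℓ where
    field
      refl′  : ∀ x → ψ x x
      sym′   : ∀ {x y} → ψ x y → ψ y x
      trans′ : ∀ {x y z} → ψ x y → ψ y z → ψ x z
      ∨-cong : ∀ {x y u v} → ψ x y → ψ u v → ψ (x ∨ u) (y ∨ v)
      ∧-cong : ∀ {x y u v} → ψ x y → ψ u v → ψ (x ∧ u) (y ∧ v)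
      φ-cong : ∀ i {x y} → ψ x y → ψ (φ i x) (φ i y)
      φ̄-cong : ∀ i {x y} → ψ x y → ψ (φ̄ i x) (φ̄ i y)

  -- ψ is principal: ψ = Cg(a,b) for some a b, i.e. (a,b) ∈ ψ and ψ is
  -- contained in every congruence containing (a,b).
  -- (Quantification over congruences is over Set₁-valued relations, which
  -- includes the level of Θ-OS.)
  IsPrincipal : (Carrier → Carrier → Set₁) → Set₂
  IsPrincipal ψ = Σ[ a ∈ Carrier ] Σ[ b ∈ Carrier ]
    (ψ a b × (∀ (χ : Carrier → Carrier → Set₁) → IsCongruence χ → χ a b →
              ∀ x y → ψ x y → χ x y))

  _∩R_ : (Carrier → Carrier → Set₁) → (Carrier → Carrier → Set₁) →
         Carrier → Carrier → Set₁
  (ψ ∩R χ) x y = ψ x y × χ x y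

-- (a,b) lies in Θ_OS(H) for the f-saturation H of σ(a) △ σ(b), which is a
-- congruence, so Cg(a,b) ⊆ Θ_OS(H). Suppose φ₁ ∩ φ₂ = Cg(a,b). A point Q of T
-- lies in R₁ ∩ f_i⁻¹(R₂), an open subset of G₁ ∩ G₂, hence in a clopen
-- σ(x) △ σ(y) ⊆ G₁ ∩ G₂; then (x,y) ∈ φ₁ ∩ φ₂ puts Q in H. On S, H reduces to
-- σ(a) △ σ(b): as f_i f_k = f_i, f_k⁻¹(G₁) ⊆ ⋃ f_i⁻¹(R₁) misses S. But
-- P₀ ∈ S ∖ T lies outside σ(a) △ σ(b) ⊆ G₂, so P₀ has a clopen neighbourhood
-- missing σ(a) △ σ(b), and by density that neighbourhood meets T.
module Submission where

open import Defs
open import Level using (0ℓ; Lift; lift) renaming (suc to lsuc)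
open import Data.Empty using (⊥; ⊥-elim)
open import Data.Product using (Σ-syntax; _×_; _,_; proj₁; proj₂)
open import Data.Sum using (_⊎_; inj₁; inj₂; [_,_]′)
import Data.Sum as Sum
open import Data.List using (List; []; _∷_; _++_; map)
open import Data.List.Relation.Unary.All using (All; []; _∷_)
import Data.List.Relation.Unary.All.Properties as All
open import Relation.Nullary using (¬_; yes; no)
open import Relation.Nullary.Decidable using (¬¬-excluded-middle)
open import Relation.Nullary.Negation using (¬¬-map)
open import Relation.Binary.Definitions using (_Respects_)
open import Relation.Binary.PropositionalEquality using (sym; trans; cong; subst)
open import Algebra.Lattice.Bundles using (DistributiveLattice)
import Algebra.Lattice.Structures as LS
import Algebra.Lattice.Properties.Lattice as LatticeProperties

module LMSpace {C : Chain} (A : LMAlgebra C) where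
  open Chain C
  open LMAlgebra A
  open LS.IsDistributiveLattice isDistributiveLattice
    using (∧-comm; ∧-assoc; ∨-comm; ∧-absorbs-∨)

  distributiveLattice : DistributiveLattice _ _
  distributiveLattice = record { isDistributiveLattice = isDistributiveLattice }

  open LatticeProperties (DistributiveLattice.lattice distributiveLattice)
    using (∧-idem)

  x∧y≤y : ∀ x y → (x ∧ y) ≤ y
  x∧y≤y x y = trans (∧-assoc x y y) (cong (x ∧_) (∧-idem y))

  x∧y≤x : ∀ x y → (x ∧ y) ≤ x
  x∧y≤x x y = subst (_≤ x) (∧-comm y x) (x∧y≤y y x)

  x≤x∨y : ∀ x y → x ≤ (x ∨ y)
  x≤x∨y = ∧-absorbs-∨

  y≤x∨y : ∀ x y → y ≤ (x ∨ y)
  y≤x∨y x y = subst (y ≤_) (∨-comm y x) (x≤x∨y y x)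

  ⋀ : List Carrier → Carrier
  ⋀ []       = 𝟙
  ⋀ (a ∷ as) = a ∧ ⋀ as

  ⋁ : List Carrier → Carrier
  ⋁ []       = 𝟘
  ⋁ (a ∷ as) = a ∨ ⋁ as

  module _ (P : X A) where
    open IsPrimeFilter (proj₂ P)

    ∈-∧⁻ : ∀ {x y} → σ A (x ∧ y) P → σ A x P × σ A y P
    ∈-∧⁻ {x} {y} p = up p (x∧y≤x x y) , up p (x∧y≤y x y)

    ∉-∨⁻ : ∀ {x y} → ¬ σ A (x ∨ y) P → ¬ σ A x P × ¬ σ A y P
    ∉-∨⁻ {x} {y} n = (λ p → n (up p (x≤x∨y x y))) , (λ p → n (up p (y≤x∨y x y)))

    ∈-⋀⁺ : ∀ {as} → All (λ a → σ A a P) as → σ A (⋀ as) P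
    ∈-⋀⁺ []       = 𝟙∈
    ∈-⋀⁺ (p ∷ ps) = ∧-closed p (∈-⋀⁺ ps)

    ∈-⋀⁻ : ∀ as → σ A (⋀ as) P → All (λ a → σ A a P) as
    ∈-⋀⁻ []       _ = []
    ∈-⋀⁻ (a ∷ as) p = proj₁ (∈-∧⁻ p) ∷ ∈-⋀⁻ as (proj₂ (∈-∧⁻ p))

    ∉-⋁⁺ : ∀ {bs} → All (λ b → ¬ σ A b P) bs → ¬ σ A (⋁ bs) P
    ∉-⋁⁺ []       p = 𝟘∉ p
    ∉-⋁⁺ (n ∷ ns) p = [ n , ∉-⋁⁺ ns ]′ (prime p)

    ∉-⋁⁻ : ∀ bs → ¬ σ A (⋁ bs) P → All (λ b → ¬ σ A b P) bs
    ∉-⋁⁻ []       _ = []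
    ∉-⋁⁻ (b ∷ bs) n = proj₁ (∉-∨⁻ n) ∷ ∉-⋁⁻ bs (proj₂ (∉-∨⁻ n))

    ∈-φ̄⇒∉-φ : ∀ i x → σ A (φ̄ i x) P → ¬ σ A (φ i x) P
    ∈-φ̄⇒∉-φ i x p q = 𝟘∉ (subst (proj₁ P) (φ-φ̄-∧ i x) (∧-closed q p))

    ∉-φ̄⇒∈-φ : ∀ i x → ¬ σ A (φ̄ i x) P → σ A (φ i x) P
    ∉-φ̄⇒∈-φ i x n = [ (λ p → p) , (λ p → ⊥-elim (n p)) ]′
      (prime (subst (proj₁ P) (sym (φ-φ̄-∨ i x)) 𝟙∈))

  _△_ : Carrier → Carrier → X A → Set
  (x △ y) P = (σ A y P × ¬ σ A x P) ⊎ (σ A x P × ¬ σ A y P)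

  module _ (P : X A) where

    △-sym : ∀ {x y} → (x △ y) P → (y △ x) P
    △-sym = Sum.swap

    △-irrefl : ∀ {x} → ¬ (x △ x) P
    △-irrefl (inj₁ (p , n)) = n p
    △-irrefl (inj₂ (p , n)) = n p

    △-trans : ∀ {x y z} → (x △ z) P → ¬ ¬ ((x △ y) P ⊎ (y △ z) P)
    △-trans (inj₁ (z∈ , x∉)) k = ¬¬-excluded-middle λ
      { (yes y∈) → k (inj₁ (inj₁ (y∈ , x∉))) ; (no y∉) → k (inj₂ (inj₁ (z∈ , y∉))) }
    △-trans (inj₂ (x∈ , z∉)) k = ¬¬-excluded-middle λ
      { (yes y∈) → k (inj₂ (inj₂ (y∈ , z∉))) ; (no y∉) → k (inj₁ (inj₂ (x∈ , y∉))) }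

    ∈∉-∨ : ∀ {x y u v} → σ A (y ∨ v) P → ¬ σ A (x ∨ u) P → (x △ y) P ⊎ (u △ v) P
    ∈∉-∨ p n with IsPrimeFilter.prime (proj₂ P) p
    ... | inj₁ y∈ = inj₁ (inj₁ (y∈ , proj₁ (∉-∨⁻ P n)))
    ... | inj₂ v∈ = inj₂ (inj₁ (v∈ , proj₂ (∉-∨⁻ P n)))

    △-∨ : ∀ {x y u v} → ((x ∨ u) △ (y ∨ v)) P → (x △ y) P ⊎ (u △ v) P
    △-∨ (inj₁ (p , n)) = ∈∉-∨ p n
    △-∨ (inj₂ (p , n)) = Sum.map △-sym △-sym (∈∉-∨ p n)

    ∈∉-∧ : ∀ {x y u v} → σ A (y ∧ v) P → ¬ σ A (x ∧ u) P → ¬ ¬ ((x △ y) P ⊎ (u △ v) P)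
    ∈∉-∧ p n k = ¬¬-excluded-middle λ
      { (yes x∈) → k (inj₂ (inj₁ (proj₂ (∈-∧⁻ P p) ,
                                  λ u∈ → n (IsPrimeFilter.∧-closed (proj₂ P) x∈ u∈))))
      ; (no x∉) → k (inj₁ (inj₁ (proj₁ (∈-∧⁻ P p) , x∉))) }

    △-∧ : ∀ {x y u v} → ((x ∧ u) △ (y ∧ v)) P → ¬ ¬ ((x △ y) P ⊎ (u △ v) P)
    △-∧ (inj₁ (p , n)) = ∈∉-∧ p n
    △-∧ (inj₂ (p , n)) = ¬¬-map (Sum.map △-sym △-sym) (∈∉-∧ p n)

    △-φ̄ : ∀ {i x y} → (φ̄ i x △ φ̄ i y) P → (φ i x △ φ i y) P
    △-φ̄ {i} {x} {y} (inj₁ (p , n)) = inj₂ (∉-φ̄⇒∈-φ P i x n , ∈-φ̄⇒∉-φ P i y p)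
    △-φ̄ {i} {x} {y} (inj₂ (p , n)) = inj₁ (∉-φ̄⇒∈-φ P i y n , ∈-φ̄⇒∉-φ P i x p)

  -- Constructively Θ_OS(H) need not be transitive (that takes deciding y ∈ P);
  -- its double-negation shift is a congruence and still contains Θ_OS(H).
  ¬¬Θ : Subset A → Carrier → Carrier → Set₁
  ¬¬Θ H x y = ∀ P → (x △ y) P → ¬ ¬ H P

  ¬¬Θ-isCongruence : {H : Subset A} → (∀ i {P} → H (f A i P) → H P) →
                     IsCongruence A (¬¬Θ H)
  ¬¬Θ-isCongruence H-closed = record
    { refl′  = λ _ P d → ⊥-elim (△-irrefl P d)
    ; sym′   = λ θ P d → θ P (△-sym P d)
    ; trans′ = λ θ θ′ P d k → △-trans P d λ e → [ θ P , θ′ P ]′ e k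
    ; ∨-cong = λ θ θ′ P d → [ θ P , θ′ P ]′ (△-∨ P d)
    ; ∧-cong = λ θ θ′ P d k → △-∧ P d λ e → [ θ P , θ′ P ]′ e k
    ; φ-cong = λ i θ P d → ¬¬-map (H-closed i) (θ (f A i P) d)
    ; φ̄-cong = λ i θ P d → ¬¬-map (H-closed i) (θ (f A i P) (△-φ̄ P d))
    }

  record _≐_ (P Q : X A) : Set where
    field
      ⊆ : _⊆X_ A P Q
      ⊇ : _⊆X_ A Q P

  f∘f≐f : ∀ i k P → f A i (f A k P) ≐ f A i P
  f∘f≐f i k P = record { ⊆ = λ x → subst (proj₁ P) (φφ k i x)
                       ; ⊇ = λ x → subst (proj₁ P) (sym (φφ k i x)) }

  IsConvex⇒Respects≐ : ∀ {R} → IsConvex A R → R Respects _≐_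
  IsConvex⇒Respects≐ convex {P} {Q} P≐Q r = convex P P Q r r (_≐_.⊆ P≐Q) (_≐_.⊇ P≐Q)

  △-Respects≐ : ∀ a b → (λ P → Lift (lsuc 0ℓ) ((a △ b) P)) Respects _≐_
  △-Respects≐ a b P≐Q (lift (inj₁ (p , n))) = lift (inj₁ (⊆ b p , λ q → n (⊇ a q)))
    where open _≐_ P≐Q
  △-Respects≐ a b P≐Q (lift (inj₂ (p , n))) = lift (inj₂ (⊆ a p , λ q → n (⊇ b q)))
    where open _≐_ P≐Q

  f⁻¹G⊆⋃f⁻¹ : ∀ {R} → R Respects _≐_ → ∀ k P → G A R (f A k P) → Σ[ i ∈ I ] (_⁻¹[_] A i R) P
  f⁻¹G⊆⋃f⁻¹ resp k P (inj₁ r)       = k , r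
  f⁻¹G⊆⋃f⁻¹ resp k P (inj₂ (i , r)) = i , resp (f∘f≐f i k P) r

  f⁻¹G⊆G : ∀ {R} → R Respects _≐_ → ∀ k {P} → G A R (f A k P) → G A R P
  f⁻¹G⊆G {R} resp k {P} g = inj₂ (f⁻¹G⊆⋃f⁻¹ {R} resp k P g)

  Basic-∩ : ∀ {as bs cs ds} P → Basic A as bs P → Basic A cs ds P →
            Basic A (as ++ cs) (bs ++ ds) P
  Basic-∩ _ (p , n) (p′ , n′) = All.++⁺ p p′ , All.++⁺ n n′

  Basic-∩⁻ : ∀ as bs {cs ds} P → Basic A (as ++ cs) (bs ++ ds) P →
             Basic A as bs P × Basic A cs ds P
  Basic-∩⁻ as bs _ (p , n) with All.++⁻ as p | All.++⁻ bs n
  ... | p₁ , p₂ | n₁ , n₂ = (p₁ , n₁) , (p₂ , n₂)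

  IsOpen-∩ : ∀ {U V} → IsOpen A U → IsOpen A V → IsOpen A (λ P → U P × V P)
  IsOpen-∩ U-open V-open P (u , v) with U-open P u | V-open P v
  ... | as , bs , B , B⊆U | cs , ds , B′ , B′⊆V =
    as ++ cs , bs ++ ds , Basic-∩ P B B′ ,
    λ Q B″ → B⊆U Q (proj₁ (Basic-∩⁻ as bs Q B″)) , B′⊆V Q (proj₂ (Basic-∩⁻ as bs Q B″))

  IsOpen-f⁻¹ : ∀ {U} i → IsOpen A U → IsOpen A (_⁻¹[_] A i U)
  IsOpen-f⁻¹ i U-open P u with U-open (f A i P) u
  ... | as , bs , (p , n) , B⊆U =
    map (φ i) as , map (φ i) bs , (All.map⁺ p , All.map⁺ n) ,
    λ Q (p′ , n′) → B⊆U (f A i Q) (All.map⁻ p′ , All.map⁻ n′)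

  Basic-open : ∀ as bs → IsOpen A (λ P → Lift (lsuc 0ℓ) (Basic A as bs P))
  Basic-open as bs P (lift B) = as , bs , B , λ Q → lift

  -- A basic open set is σ(⋀ as) ∖ σ(⋁ bs), which is the symmetric difference
  -- of σ(⋀ as ∧ ⋁ bs) ⊆ σ(⋀ as) and σ(⋀ as).
  Basic⇒△ : ∀ {as bs} P → Basic A as bs P → ((⋀ as ∧ ⋁ bs) △ ⋀ as) P
  Basic⇒△ P (p , n) =
    inj₁ (∈-⋀⁺ P p , λ q → ∉-⋁⁺ P n (proj₂ (∈-∧⁻ P q)))

  △⇒Basic : ∀ as bs P → ((⋀ as ∧ ⋁ bs) △ ⋀ as) P → Basic A as bs P
  △⇒Basic as bs P (inj₁ (p , n)) =
    ∈-⋀⁻ P as p , ∉-⋁⁻ P bs (λ q → n (IsPrimeFilter.∧-closed (proj₂ P) p q))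
  △⇒Basic _ _ P (inj₂ (q , n)) = ⊥-elim (n (proj₁ (∈-∧⁻ P q)))

  IsOpen⇒△-nbhd : ∀ {U} → IsOpen A U → ∀ P → U P →
                  Σ[ x ∈ Carrier ] Σ[ y ∈ Carrier ] ((x △ y) P × (∀ Q → (x △ y) Q → U Q))
  IsOpen⇒△-nbhd U-open P u with U-open P u
  ... | as , bs , B , B⊆U = ⋀ as ∧ ⋁ bs , ⋀ as , Basic⇒△ P B , λ Q d → B⊆U Q (△⇒Basic as bs Q d)

  ∉△⇒¬¬Basic-nbhd : ∀ a b P → ¬ (a △ b) P →
    ¬ ¬ (Σ[ as ∈ List Carrier ] Σ[ bs ∈ List Carrier ]
           (Basic A as bs P × (∀ Q → Basic A as bs Q → ¬ (a △ b) Q)))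
  ∉△⇒¬¬Basic-nbhd a b P P∉ k = ¬¬-excluded-middle λ
    { (yes a∈) → ¬¬-excluded-middle λ
        { (yes b∈) → k (a ∷ b ∷ [] , [] , (a∈ ∷ b∈ ∷ [] , []) , both-in)
        ; (no b∉)  → P∉ (inj₂ (a∈ , b∉)) }
    ; (no a∉) → ¬¬-excluded-middle λ
        { (yes b∈) → P∉ (inj₁ (b∈ , a∉))
        ; (no b∉)  → k ([] , a ∷ b ∷ [] , ([] , a∉ ∷ b∉ ∷ []) , both-out) } }
    where
    both-in : ∀ Q → Basic A (a ∷ b ∷ []) [] Q → ¬ (a △ b) Q
    both-in Q ((a∈ ∷ b∈ ∷ []) , []) = [ (λ (_ , a∉) → a∉ a∈) , (λ (_ , b∉) → b∉ b∈) ]′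
    both-out : ∀ Q → Basic A [] (a ∷ b ∷ []) Q → ¬ (a △ b) Q
    both-out Q ([] , (a∉ ∷ b∉ ∷ [])) = [ (λ (b∈ , _) → b∉ b∈) , (λ (a∈ , _) → a∉ a∈) ]′

proposition3p7 : (C : Chain) (A : LMAlgebra C) →
    let open Chain C in
    (R₁ R₂ : Subset A) →
    IsClosed A R₁ → IsOpen A R₁ → IsConvex A R₁ →
    IsClosed A R₂ → IsOpen A R₂ → IsConvex A R₂ →
    let S : Subset A
        S = λ P → R₁ P × ¬ (R₂ P ⊎ Σ[ i ∈ I ] (_⁻¹[_] A i R₁) P)
        T : Subset A
        T = λ P → S P × Σ[ i ∈ I ] (_⁻¹[_] A i R₂) P
    in
    Σ[ P ∈ X A ] (S P × ¬ T P) →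
    (∀ (U : Subset A) → IsOpen A U →
       Σ[ P ∈ X A ] (U P × S P) → Σ[ Q ∈ X A ] (U Q × T Q)) →
    ¬ IsPrincipal A (_∩R_ A (Θ-OS A (G A R₁)) (Θ-OS A (G A R₂)))
proposition3p7 C A R₁ R₂ _ R₁-open R₁-convex _ R₂-open _
               (P₀ , P₀∈S , P₀∉T) dense (a , b , (ab∈φ₁ , ab∈φ₂) , least) =
  ∉△⇒¬¬Basic-nbhd a b P₀ P₀∉△ λ (as , bs , B , B∩△=∅) →
    let (Q , lift BQ , Q∈T) = dense _ (Basic-open as bs) (P₀ , lift B , P₀∈S)
    in  T⊆¬¬H Q Q∈T λ h → B∩△=∅ Q BQ (H∩S⊆△ Q (proj₁ Q∈T) h)
  where
  open Chain C
  open LMSpace A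

  S : Subset A
  S P = R₁ P × ¬ (R₂ P ⊎ Σ[ i ∈ I ] (_⁻¹[_] A i R₁) P)

  T : Subset A
  T P = S P × Σ[ i ∈ I ] (_⁻¹[_] A i R₂) P

  H : Subset A
  H = G A (λ P → Lift _ ((a △ b) P))

  φ₁∩φ₂⊆¬¬Θ : ∀ x y → _∩R_ A (Θ-OS A (G A R₁)) (Θ-OS A (G A R₂)) x y → ¬¬Θ H x y
  φ₁∩φ₂⊆¬¬Θ = least (¬¬Θ H) (¬¬Θ-isCongruence (f⁻¹G⊆G (△-Respects≐ a b)))
                (λ P d k → k (inj₁ (lift d)))

  P₀∉△ : ¬ (a △ b) P₀
  P₀∉△ d = [ (λ r → proj₂ P₀∈S (inj₁ r)) , (λ e → P₀∉T (P₀∈S , e)) ]′ (ab∈φ₂ P₀ d)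

  H∩S⊆△ : ∀ Q → S Q → H Q → (a △ b) Q
  H∩S⊆△ Q _ (inj₁ (lift d)) = d
  H∩S⊆△ Q (_ , Q∉) (inj₂ (k , lift d)) =
    ⊥-elim (Q∉ (inj₂ (f⁻¹G⊆⋃f⁻¹ (IsConvex⇒Respects≐ R₁-convex) k Q (ab∈φ₁ (f A k Q) d))))

  T⊆¬¬H : ∀ Q → T Q → ¬ ¬ H Q
  T⊆¬¬H Q ((R₁Q , _) , i , R₂fQ)
    with IsOpen⇒△-nbhd (IsOpen-∩ R₁-open (IsOpen-f⁻¹ i R₂-open)) Q (R₁Q , R₂fQ)
  ... | x , y , Q∈ , ⊆R₁∩f⁻¹R₂ =
    φ₁∩φ₂⊆¬¬Θ x y ((λ P d → inj₁ (proj₁ (⊆R₁∩f⁻¹R₂ P d)))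
                  , (λ P d → inj₂ (i , proj₂ (⊆R₁∩f⁻¹R₂ P d)))) Q Q∈
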